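{- Let $F$ be a clause-set and $G := D(F)$. (1) The map $F'\mapsto\mathrm{pure}(F')$ is a bijection from $\mathrm{mps}(G)$ to $\mathrm{prc}_0(G)$. (2) Its inverse sends $C\in\mathrm{prc}_0(G)$ to $\{D\cup\{u_D\} : D\in F,\ u_D\in\mathrm{var}(C)\}$.
   Context: Clauses are finite sets of literals without complementary pair; clause-sets finite sets of clauses. $\mathrm{prc}_0(G)$: prime implicates of $G$ (inclusion-minimal clauses $C$ with $G\models C$). A clause-set $H$ is a minimal premise set (mps) for a clause $C$ if $H\models C$ and no proper subset of $H$ implies $C$; $H$ is an mps if it is an mps for some clause; $\mathrm{mps}(G)$ is the set of subsets of $G$ that are mps's. $\mathrm{pure}(H)$: literals occurring in $H$ whose complement does not occur in $H$. Doping: each clause $D\in F$ gets a distinct new variable $u_D\notin\mathrm{var}(F)$ and $D(F):=\{D\cup\{u_D\}: D\in F\}$. -}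

module Defs where

open import Data.Nat using (ℕ)
import Data.Nat as ℕ
open import Data.Bool using (Bool; true; false; not)
import Data.Bool as B
open import Data.Product using (Σ; ∃; _×_; _,_; proj₁; proj₂)
open import Data.Product.Properties using (≡-dec)
open import Data.List using (List; []; _∷_; map; concat; filter)
open import Data.List.Relation.Unary.Any using (Any)
open import Data.List.Relation.Unary.All using (All)
open import Data.List.Membership.Propositional using (_∈_; _∉_)
open import Relation.Binary.PropositionalEquality using (_≡_; _≢_)
open import Relation.Binary.Definitions using (DecidableEquality)
open import Relation.Nullary using (¬_; ¬?)
open import Function.Bundles using (_⇔_)
import Data.List.Membership.DecPropositional as DecMem

-- Variables are natural numbers; a literal is a variable with a sign
-- (true = positive, false = negative).
Var : Set
Var = ℕ

Lit : Set
Lit = Var × Bool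

compl : Lit → Lit
compl (v , b) = (v , not b)

_≟L_ : DecidableEquality Lit
_≟L_ = ≡-dec ℕ._≟_ B._≟_

open DecMem _≟L_ using (_∈?_)

-- Finite sets are represented by lists, read extensionally (by membership).
Clause : Set
Clause = List Lit

IsClause : Clause → Set
IsClause C = ∀ x → x ∈ C → compl x ∉ C

var : Clause → List Var
var C = map proj₁ C

_⊆C_ : Clause → Clause → Set
C ⊆C C' = ∀ x → x ∈ C → x ∈ C'

_≈C_ : Clause → Clause → Set
C ≈C C' = ∀ x → (x ∈ C) ⇔ (x ∈ C')

ClauseSet : Set
ClauseSet = List Clause

_∈S_ : Clause → ClauseSet → Set
D ∈S F = Any (λ D' → D ≈C D') F

_⊆S_ : ClauseSet → ClauseSet → Set
H ⊆S H' = ∀ D → D ∈S H → D ∈S H'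

_≈S_ : ClauseSet → ClauseSet → Set
H ≈S H' = (H ⊆S H') × (H' ⊆S H)

_⊂S_ : ClauseSet → ClauseSet → Set
H' ⊂S H = (H' ⊆S H) × ¬ (H ⊆S H')

lits : ClauseSet → List Lit
lits H = concat H

Assignment : Set
Assignment = Var → Bool

SatL : Assignment → Lit → Set
SatL φ (v , b) = φ v ≡ b

SatC : Assignment → Clause → Set
SatC φ C = Any (SatL φ) C

SatS : Assignment → ClauseSet → Set
SatS φ F = All (SatC φ) F

_⊨_ : ClauseSet → Clause → Set
F ⊨ C = ∀ (φ : Assignment) → SatS φ F → SatC φ C

Prc0 : ClauseSet → Clause → Set
Prc0 G C = IsClause C × (G ⊨ C) ×
  (∀ C' → IsClause C' → C' ⊆C C → G ⊨ C' → C ⊆C C')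

MPSFor : ClauseSet → Clause → Set
MPSFor H C = (H ⊨ C) × (∀ H' → H' ⊂S H → ¬ (H' ⊨ C))

IsMPS : ClauseSet → Set
IsMPS H = Σ Clause (λ C → IsClause C × MPSFor H C)

InMps : ClauseSet → ClauseSet → Set
InMps G H = (H ⊆S G) × IsMPS H

pure : ClauseSet → Clause
pure H = filter (λ x → ¬? (compl x ∈? lits H)) (lits H)

-- Doping with respect to a choice u of new variables u_D
dope1 : (Clause → Var) → Clause → Clause
dope1 u D = (u D , true) ∷ D

dope : (Clause → Var) → ClauseSet → ClauseSet
dope u F = map (dope1 u) F

ValidDoping : ClauseSet → (Clause → Var) → Set
ValidDoping F u =
  (∀ D D' → D ∈S F → D' ∈S F → u D ≡ u D' → D ≈C D') ×
  (∀ D D' → D ∈S F → D' ∈S F → D ≈C D' → u D ≡ u D') ×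
  (∀ D → D ∈S F → u D ∉ var (lits F))

invMap : ClauseSet → (Clause → Var) → Clause → ClauseSet
invMap F u C = map (dope1 u) (filter (λ D → DecMem._∈?_ ℕ._≟_ (u D) (var C)) F)

-- Every clause D ∪ {u_D} of D(F) carries a positive literal u_D occurring nowhere
-- else, so u_D is pure in any H ⊆ D(F) containing that clause: H is recovered from
-- pure(H) as the clauses whose u_D occurs in it. Conversely, setting true every u_D
-- outside var(C) shows that C follows from the clauses of D(F) whose u_D lies in
-- var(C). The rest is general: the pure literals of an mps H for C lie in C
-- and are implied by H, and a prime implicate of G has all its literals in every
-- H ⊆ G implying it.
module Submission where

open import Defs
open import Data.Bool using (true; false; _≟_)
open import Data.Bool.Properties using (not-¬; ¬-not; not-involutive)
open import Data.Empty using (⊥-elim)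
open import Data.List using (List; [_]; map; filter)
open import Data.List.Membership.Propositional using (_∈_; _∉_; find; lose)
open import Data.List.Membership.Propositional.Properties
  using (∈-map⁺; ∈-map⁻; ∈-filter⁺; ∈-filter⁻; ∈-concat⁺′; ∈-concat⁻′)
import Data.List.Membership.DecPropositional as DecMem
open import Data.List.Relation.Unary.All as All using (All)
open import Data.List.Relation.Unary.Any as Any using (Any; here; there; any?)
import Data.Nat as ℕ
open import Data.Product using (Σ; ∃; _×_; _,_; proj₁; proj₂)
open import Data.Sum using (_⊎_; inj₁; inj₂)
open import Function.Bundles using (mk⇔; Equivalence)
open import Function.Construct.Identity using (⇔-id)
open import Function.Construct.Symmetry using (⇔-sym)
open import Function.Construct.Composition using (_⇔-∘_)
open import Relation.Binary.PropositionalEquality using (_≡_; _≢_; refl; sym; trans; cong; cong₂; subst)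
open import Relation.Nullary using (¬_; ¬?; Dec; yes; no)

open DecMem _≟L_ using (_∈?_)
open DecMem ℕ._≟_ using () renaming (_∈?_ to _∈ᵛ?_)

Any-map∈ : ∀ {A : Set} {P Q : A → Set} {xs : List A} →
  (∀ {y} → y ∈ xs → P y → Q y) → Any P xs → Any Q xs
Any-map∈ f p with find p
... | y , y∈ , py = lose y∈ (f y∈ py)

compl-≢ : ∀ x → compl x ≢ x
compl-≢ (v , b) eq = not-¬ refl (sym (cong proj₂ eq))

compl-involutive : ∀ x → compl (compl x) ≡ x
compl-involutive (v , b) = cong (v ,_) (not-involutive b)

compl-injective : ∀ {x y} → compl x ≡ compl y → x ≡ y
compl-injective {x} {y} eq =
  trans (sym (compl-involutive x)) (trans (cong compl eq) (compl-involutive y))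

≈C-refl : ∀ {C} → C ≈C C
≈C-refl _ = ⇔-id _

≈C-sym : ∀ {C C'} → C ≈C C' → C' ≈C C
≈C-sym e x = ⇔-sym (e x)

≈C-trans : ∀ {C C' C''} → C ≈C C' → C' ≈C C'' → C ≈C C''
≈C-trans e f x = f x ⇔-∘ e x

≈C⇒⊆C : ∀ {C C'} → C ≈C C' → C ⊆C C'
≈C⇒⊆C e x = Equivalence.to (e x)

∈⇒∈S : ∀ {D H} → D ∈ H → D ∈S H
∈⇒∈S m = lose m ≈C-refl

∈S-resp-≈C : ∀ {D D' H} → D ≈C D' → D' ∈S H → D ∈S H
∈S-resp-≈C e = Any.map (≈C-trans e)

⊆S-refl : ∀ {H} → H ⊆S H
⊆S-refl _ p = p

⊆S-trans : ∀ {H H' H''} → H ⊆S H' → H' ⊆S H'' → H ⊆S H''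
⊆S-trans sub sub' E p = sub' E (sub E p)

∈S-lits : ∀ {x E H} → x ∈ E → E ∈S H → x ∈ lits H
∈S-lits x∈E E∈H with find E∈H
... | E' , E'∈H , e = ∈-concat⁺′ (≈C⇒⊆C e _ x∈E) E'∈H

⊆S-lits : ∀ {H H'} → H ⊆S H' → lits H ⊆C lits H'
⊆S-lits {H} sub x x∈ with ∈-concat⁻′ H x∈
... | E , x∈E , E∈H = ∈S-lits x∈E (sub E (∈⇒∈S E∈H))

var⁺ : ∀ {x C} → x ∈ C → proj₁ x ∈ var C
var⁺ = ∈-map⁺ proj₁

var-mono : ∀ {C C'} → C ⊆C C' → ∀ {v} → v ∈ var C → v ∈ var C'
var-mono sub m with ∈-map⁻ proj₁ m
... | x , x∈ , refl = var⁺ (sub x x∈)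

⊆C-isClause : ∀ {C C'} → IsClause C → C' ⊆C C → IsClause C'
⊆C-isClause c sub x x∈ cx∈ = c x (sub x x∈) (sub _ cx∈)

[]-isClause : ∀ x → IsClause [ x ]
[]-isClause x .x (here refl) (here eq) = compl-≢ x eq

infixl 30 _∖_
_∖_ : Clause → List Lit → Clause
C ∖ L = filter (λ z → ¬? (z ∈? L)) C

∈-∖⁺ : ∀ {z C L} → z ∈ C → z ∉ L → z ∈ C ∖ L
∈-∖⁺ = ∈-filter⁺ (λ z → ¬? (z ∈? _))

∈-∖⁻ : ∀ {z} C {L} → z ∈ C ∖ L → z ∈ C × z ∉ L
∈-∖⁻ C = ∈-filter⁻ (λ z → ¬? (z ∈? _)) {xs = C}

∖-⊆C : ∀ {C L} → C ∖ L ⊆C C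
∖-⊆C {C} z z∈ = proj₁ (∈-∖⁻ C z∈)

∖∖-⊆C : ∀ {C L} → C ∖ (C ∖ L) ⊆C L
∖∖-⊆C {C} {L} z z∈ with ∈-∖⁻ C z∈ | z ∈? L
... | _ | yes z∈L = z∈L
... | z∈C , z∉C∖L | no z∉L = ⊥-elim (z∉C∖L (∈-∖⁺ z∈C z∉L))

∈-pure⁺ : ∀ {x} H → x ∈ lits H → compl x ∉ lits H → x ∈ pure H
∈-pure⁺ H = ∈-filter⁺ (λ x → ¬? (compl x ∈? lits H))

∈-pure⁻ : ∀ {x} H → x ∈ pure H → x ∈ lits H × compl x ∉ lits H
∈-pure⁻ H = ∈-filter⁻ (λ x → ¬? (compl x ∈? lits H)) {xs = lits H}

pure-isClause : ∀ H → IsClause (pure H)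
pure-isClause H x x∈ cx∈ = proj₂ (∈-pure⁻ H x∈) (proj₁ (∈-pure⁻ H cx∈))

SatC? : ∀ φ C → Dec (SatC φ C)
SatC? φ = any? (λ x → φ (proj₁ x) ≟ proj₂ x)

SatC-⊆C : ∀ {φ E E'} → E ⊆C E' → SatC φ E → SatC φ E'
SatC-⊆C sub s with find s
... | x , x∈ , sx = lose (sub x x∈) sx

SatS-⊆S : ∀ {φ H H'} → H ⊆S H' → SatS φ H' → SatS φ H
SatS-⊆S {φ} {H} {H'} sub s = All.tabulate λ {E} E∈ → SatC-∈S (sub E (∈⇒∈S E∈))
  where
  SatC-∈S : ∀ {E} → E ∈S H' → SatC φ E
  SatC-∈S E∈ with find E∈
  ... | E' , E'∈ , e = SatC-⊆C (≈C⇒⊆C (≈C-sym e)) (All.lookup s E'∈)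

⊨-mono : ∀ {H H' C} → H ⊆S H' → H ⊨ C → H' ⊨ C
⊨-mono sub ent φ s = ent φ (SatS-⊆S sub s)

⊨-weaken : ∀ {H C C'} → C ⊆C C' → H ⊨ C → H ⊨ C'
⊨-weaken sub ent φ s = SatC-⊆C sub (ent φ s)

falsify : Clause → Assignment → Assignment
falsify L φ v with (v , true) ∈? L | (v , false) ∈? L
... | yes _ | _     = false
... | no _  | yes _ = true
... | no _  | no _  = φ v

falsify-falsifies : ∀ {L φ z} → IsClause L → z ∈ L → ¬ SatL (falsify L φ) z
falsify-falsifies {L} {φ} {v , true} _ z∈ sat with (v , true) ∈? L | (v , false) ∈? L
... | yes _ | _ = not-¬ refl (sym sat)
... | no z∉ | _ = z∉ z∈
falsify-falsifies {L} {φ} {v , false} cL z∈ sat with (v , true) ∈? L | (v , false) ∈? L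
... | yes cz∈ | _  = cL (v , false) z∈ cz∈
... | no _ | yes _ = not-¬ refl (sym sat)
... | no _ | no z∉ = z∉ z∈

falsify-compl : ∀ {L φ y} → IsClause L → compl y ∈ L → SatL (falsify L φ) y
falsify-compl {y = v , b} cL cy∈ =
  trans (¬-not (falsify-falsifies cL cy∈)) (not-involutive b)

falsify-agrees : ∀ {L φ y} → y ∉ L → compl y ∉ L → falsify L φ (proj₁ y) ≡ φ (proj₁ y)
falsify-agrees {L} {φ} {v , true} y∉ cy∉ with (v , true) ∈? L | (v , false) ∈? L
... | yes y∈ | _     = ⊥-elim (y∉ y∈)
... | no _  | yes cy∈ = ⊥-elim (cy∉ cy∈)
... | no _  | no _   = refl
falsify-agrees {L} {φ} {v , false} y∉ cy∉ with (v , true) ∈? L | (v , false) ∈? L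
... | yes cy∈ | _    = ⊥-elim (cy∉ cy∈)
... | no _  | yes y∈ = ⊥-elim (y∉ y∈)
... | no _  | no _   = refl

-- The reduct of H ⊨ C under the partial assignment falsifying L.
⊨-reduct : ∀ {H H' C L} → IsClause L →
  (∀ z → z ∈ C → compl z ∉ L) →
  (∀ y → y ∈ lits H' → y ∉ L) →
  (∀ E → E ∈ H → E ∈S H' ⊎ Any (λ y → compl y ∈ L) E) →
  H ⊨ C → H' ⊨ C ∖ L
⊨-reduct {H} {H'} {C} {L} cL C-avoids H'-avoids covered H⊨C φ φ⊨H' =
  SatC∖L (find (H⊨C ψ (All.tabulate (λ {E} → ψ⊨E E))))
  where
  ψ : Assignment
  ψ = falsify L φ
  lift : ∀ {y} → y ∉ L → SatL φ y → SatL ψ y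
  lift {y} y∉ sat with compl y ∈? L
  ... | yes cy∈ = falsify-compl cL cy∈
  ... | no cy∉ = trans (falsify-agrees y∉ cy∉) sat
  ψ⊨E : ∀ E → E ∈ H → SatC ψ E
  ψ⊨E E E∈ with covered E E∈
  ... | inj₂ cy∈L = Any.map (falsify-compl cL) cy∈L
  ... | inj₁ E∈H' with find E∈H'
  ... | E' , E'∈ , e = SatC-⊆C (≈C⇒⊆C (≈C-sym e))
        (Any-map∈ (λ y∈ → lift (H'-avoids _ (∈-concat⁺′ y∈ E'∈))) (All.lookup φ⊨H' E'∈))
  SatC∖L : (∃ λ z → z ∈ C × SatL ψ z) → SatC φ (C ∖ L)
  SatC∖L (z , z∈C , sat) =
    lose (∈-∖⁺ z∈C z∉L) (trans (sym (falsify-agrees z∉L (C-avoids z z∈C))) sat)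
    where
    z∉L : z ∉ L
    z∉L z∈L = falsify-falsifies cL z∈L sat

⊨-restrict : ∀ {H C} → IsClause C → H ⊨ C → H ⊨ C ∖ (C ∖ lits H)
⊨-restrict {H} {C} cC =
  ⊨-reduct (⊆C-isClause cC ∖-⊆C) C-avoids H-avoids (λ E E∈ → inj₁ (∈⇒∈S E∈))
  where
  C-avoids : ∀ z → z ∈ C → compl z ∉ C ∖ lits H
  C-avoids z z∈ cz∈ = cC z z∈ (∖-⊆C _ cz∈)
  H-avoids : ∀ y → y ∈ lits H → y ∉ C ∖ lits H
  H-avoids y y∈ y∈∖ = proj₂ (∈-∖⁻ C y∈∖) y∈

prc₀-⊆lits : ∀ {G H C} → Prc0 G C → H ⊆S G → H ⊨ C → C ⊆C lits H
prc₀-⊆lits {G} {H} {C} (cC , _ , minimal) H⊆G H⊨C x x∈C =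
  ∖∖-⊆C {C} x (minimal _ (⊆C-isClause cC ∖-⊆C) ∖-⊆C G⊨C∩H x x∈C)
  where
  G⊨C∩H : G ⊨ C ∖ (C ∖ lits H)
  G⊨C∩H = ⊨-mono H⊆G (⊨-restrict cC H⊨C)

avoiding : Lit → ClauseSet → ClauseSet
avoiding y H = filter (λ E → ¬? (y ∈? E)) H

avoiding-∈⁺ : ∀ {y E} H → E ∈ H → y ∉ E → E ∈ avoiding y H
avoiding-∈⁺ {y} H = ∈-filter⁺ (λ E → ¬? (y ∈? E))

avoiding-∈⁻ : ∀ {y E} H → E ∈ avoiding y H → E ∈ H × y ∉ E
avoiding-∈⁻ {y} H = ∈-filter⁻ (λ E → ¬? (y ∈? E)) {xs = H}

avoiding-⊆S : ∀ {y} H → avoiding y H ⊆S H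
avoiding-⊆S H E E∈ with find E∈
... | E' , E'∈ , e = lose (proj₁ (avoiding-∈⁻ H E'∈)) e

avoiding-⊂S : ∀ {y} H → y ∈ lits H → avoiding y H ⊂S H
avoiding-⊂S {y} H y∈ = avoiding-⊆S H , not-⊇
  where
  not-⊇ : ¬ (H ⊆S avoiding y H)
  not-⊇ sup with ∈-concat⁻′ H y∈
  ... | E , y∈E , E∈H with find (sup E (∈⇒∈S E∈H))
  ... | E' , E'∈ , e = proj₂ (avoiding-∈⁻ H E'∈) (≈C⇒⊆C e y y∈E)

MPSFor-⊆C : ∀ {H C C'} → MPSFor H C → C' ⊆C C → H ⊨ C' → MPSFor H C'
MPSFor-⊆C (_ , minimal) C'⊆C H⊨C' =
  H⊨C' , λ H' H'⊂H H'⊨C' → minimal H' H'⊂H (⊨-weaken C'⊆C H'⊨C')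

-- If compl y occurred in H, the clauses containing it could be dropped:
-- an assignment falsifying C falsifies y, hence satisfies all of them.
mps-compl∉ : ∀ {H C y} → MPSFor H C → y ∈ C → compl y ∉ lits H
mps-compl∉ {H} {C} {y} (H⊨C , minimal) y∈C cy∈H =
  minimal (avoiding (compl y) H) (avoiding-⊂S H cy∈H) avoiding⊨C
  where
  avoiding⊨C : avoiding (compl y) H ⊨ C
  avoiding⊨C φ φ⊨ with SatC? φ C
  ... | yes sat = sat
  ... | no unsat = ⊥-elim (unsat (H⊨C φ (All.tabulate (λ {E} → φ⊨E E))))
    where
    φ⊨E : ∀ E → E ∈ H → SatC φ E
    φ⊨E E E∈ with compl y ∈? E
    ... | yes cy∈E = lose cy∈E (¬-not (λ sat → unsat (lose y∈C sat)))
    ... | no cy∉E = All.lookup φ⊨ (avoiding-∈⁺ H E∈ cy∉E)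

mps-pure⊆C : ∀ {H C} → MPSFor H C → pure H ⊆C C
mps-pure⊆C {H} {C} (H⊨C , minimal) x x∈ with x ∈? C | ∈-pure⁻ H x∈
... | yes x∈C | _ = x∈C
... | no x∉C | x∈H , cx∉H =
  ⊥-elim (minimal (avoiding x H) (avoiding-⊂S H x∈H) (⊨-weaken ∖-⊆C reduct))
  where
  C-avoids : ∀ z → z ∈ C → compl z ∉ [ compl x ]
  C-avoids z z∈ (here eq) = x∉C (subst (_∈ C) (compl-injective eq) z∈)
  H-avoids : ∀ y → y ∈ lits (avoiding x H) → y ∉ [ compl x ]
  H-avoids y y∈ (here refl) = cx∉H (⊆S-lits (avoiding-⊆S H) y y∈)
  covered : ∀ E → E ∈ H → E ∈S avoiding x H ⊎ Any (λ y → compl y ∈ [ compl x ]) E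
  covered E E∈ with x ∈? E
  ... | yes x∈E = inj₂ (lose x∈E (here refl))
  ... | no x∉E = inj₁ (∈⇒∈S (avoiding-∈⁺ H E∈ x∉E))
  reduct : avoiding x H ⊨ C ∖ [ compl x ]
  reduct = ⊨-reduct ([]-isClause (compl x)) C-avoids H-avoids covered H⊨C

mps-⊨-pure : ∀ {H C} → IsClause C → MPSFor H C → H ⊨ pure H
mps-⊨-pure {H} {C} cC mps = ⊨-weaken ⊆pure (⊨-restrict cC (proj₁ mps))
  where
  ⊆pure : C ∖ (C ∖ lits H) ⊆C pure H
  ⊆pure z z∈ = ∈-pure⁺ H (∖∖-⊆C {C} z z∈) (mps-compl∉ mps (∖-⊆C z z∈))

negatives : List Var → Clause
negatives = map (_, false)

negatives-isClause : ∀ vs → IsClause (negatives vs)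
negatives-isClause vs x x∈ cx∈ with ∈-map⁻ (_, false) x∈ | ∈-map⁻ (_, false) cx∈
... | _ , _ , refl | _ , _ , ()

module Doping (F : ClauseSet) (u : Clause → Var)
  (u-injective : ∀ D D' → D ∈S F → D' ∈S F → u D ≡ u D' → D ≈C D')
  (u-fresh : ∀ D → D ∈S F → u D ∉ var (lits F)) where

  u-fresh-lit : ∀ {D x} → D ∈ F → x ∈ lits F → proj₁ x ≢ u D
  u-fresh-lit D∈ x∈ eq = u-fresh _ (∈⇒∈S D∈) (subst (_∈ var (lits F)) eq (var⁺ x∈))

  lits-dope⁻ : ∀ {x} → x ∈ lits (dope u F) →
    (∃ λ D → D ∈ F × x ≡ (u D , true)) ⊎ x ∈ lits F
  lits-dope⁻ m with ∈-concat⁻′ (dope u F) m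
  ... | E , x∈E , E∈ with ∈-map⁻ (dope1 u) E∈
  ... | D , D∈ , refl with x∈E
  ... | here eq = inj₁ (D , D∈ , eq)
  ... | there x∈D = inj₂ (∈-concat⁺′ x∈D D∈)

  u-positive : ∀ {D b} → D ∈ F → (u D , b) ∈ lits (dope u F) → b ≡ true
  u-positive D∈ m with lits-dope⁻ m
  ... | inj₁ (_ , _ , eq) = cong proj₂ eq
  ... | inj₂ m' = ⊥-elim (u-fresh-lit D∈ m' refl)

  u-negative-∉ : ∀ {v} → (v , false) ∈ lits (dope u F) → v ∉ map u F
  u-negative-∉ m v∈ with ∈-map⁻ u v∈
  ... | D , D∈ , refl with u-positive D∈ m
  ... | ()

  ∈S-dope⁻ : ∀ {E} → E ∈S dope u F → ∃ λ D → D ∈ F × E ≈C dope1 u D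
  ∈S-dope⁻ E∈ with find E∈
  ... | E' , E'∈ , e with ∈-map⁻ (dope1 u) E'∈
  ... | D , D∈ , refl = D , D∈ , e

  dope1-⊆C : ∀ {D D'} → u D ≡ u D' → D ⊆C D' → dope1 u D ⊆C dope1 u D'
  dope1-⊆C eq sub x (here x≡u) = here (trans x≡u (cong (_, true) eq))
  dope1-⊆C eq sub x (there x∈) = there (sub x x∈)

  dope1-≈C : ∀ {D D'} → D ∈ F → D' ∈ F → u D ≡ u D' → dope1 u D ≈C dope1 u D'
  dope1-≈C {D} {D'} D∈ D'∈ eq x =
    mk⇔ (dope1-⊆C eq (≈C⇒⊆C e) x) (dope1-⊆C (sym eq) (≈C⇒⊆C (≈C-sym e)) x)
    where
    e : D ≈C D'
    e = u-injective _ _ (∈⇒∈S D∈) (∈⇒∈S D'∈) eq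

  ∈S-invMap⁻ : ∀ {E C} → E ∈S invMap F u C →
    ∃ λ D → D ∈ F × u D ∈ var C × E ≈C dope1 u D
  ∈S-invMap⁻ {C = C} E∈ with find E∈
  ... | E' , E'∈ , e with ∈-map⁻ (dope1 u) E'∈
  ... | D , D∈′ , refl with ∈-filter⁻ (λ D → u D ∈ᵛ? var C) {xs = F} D∈′
  ... | D∈ , uD∈ = D , D∈ , uD∈ , e

  ∈S-invMap⁺ : ∀ {E C D} → D ∈ F → u D ∈ var C → E ≈C dope1 u D → E ∈S invMap F u C
  ∈S-invMap⁺ {C = C} D∈ uD∈ =
    lose (∈-map⁺ (dope1 u) (∈-filter⁺ (λ D → u D ∈ᵛ? var C) D∈ uD∈))

  invMap-⊆S : ∀ C → invMap F u C ⊆S dope u F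
  invMap-⊆S C E E∈ with ∈S-invMap⁻ {C = C} E∈
  ... | D , D∈ , _ , e = lose (∈-map⁺ (dope1 u) D∈) e

  invMap-mono : ∀ {C C'} → C ⊆C C' → invMap F u C ⊆S invMap F u C'
  invMap-mono {C} sub E E∈ with ∈S-invMap⁻ {C = C} E∈
  ... | D , D∈ , uD∈ , e = ∈S-invMap⁺ D∈ (var-mono sub uD∈) e

  u∈lits⇒dope1∈S : ∀ {H D b} → H ⊆S dope u F → D ∈ F → (u D , b) ∈ lits H → dope1 u D ∈S H
  u∈lits⇒dope1∈S {H} {D} H⊆G D∈ m with ∈-concat⁻′ H m
  ... | E , x∈E , E∈H with ∈S-dope⁻ (H⊆G E (∈⇒∈S E∈H))
  ... | D' , D'∈ , e with ≈C⇒⊆C e _ x∈E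
  ... | here eq = lose E∈H (≈C-trans (dope1-≈C D∈ D'∈ (cong proj₁ eq)) (≈C-sym e))
  ... | there x∈D' = ⊥-elim (u-fresh-lit D∈ (∈-concat⁺′ x∈D' D'∈) refl)

  invMap-⊨ : ∀ {C} → dope u F ⊨ C → invMap F u C ⊨ C
  invMap-⊨ {C} G⊨C =
    ⊨-weaken ∖-⊆C (⊨-reduct (negatives-isClause fresh) C-avoids K-avoids covered G⊨C)
    where
    fresh : List Var
    fresh = filter (λ v → ¬? (v ∈ᵛ? var C)) (map u F)
    ∈-fresh⁻ : ∀ {v} → v ∈ fresh → v ∈ map u F × v ∉ var C
    ∈-fresh⁻ = ∈-filter⁻ (λ v → ¬? (v ∈ᵛ? var C)) {xs = map u F}
    C-avoids : ∀ z → z ∈ C → compl z ∉ negatives fresh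
    C-avoids z z∈ cz∈ with ∈-map⁻ (_, false) cz∈
    ... | v , v∈ , eq = proj₂ (∈-fresh⁻ v∈) (subst (_∈ var C) (cong proj₁ eq) (var⁺ z∈))
    K-avoids : ∀ y → y ∈ lits (invMap F u C) → y ∉ negatives fresh
    K-avoids y y∈ y∈L with ∈-map⁻ (_, false) y∈L
    ... | v , v∈ , refl = u-negative-∉ (⊆S-lits (invMap-⊆S C) _ y∈) (proj₁ (∈-fresh⁻ v∈))
    covered : ∀ E → E ∈ dope u F → E ∈S invMap F u C ⊎ Any (λ y → compl y ∈ negatives fresh) E
    covered E E∈ with ∈-map⁻ (dope1 u) E∈
    ... | D , D∈ , refl with u D ∈ᵛ? var C
    ... | yes uD∈ = inj₁ (∈S-invMap⁺ D∈ uD∈ ≈C-refl)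
    ... | no uD∉ =
      inj₂ (here (∈-map⁺ (_, false) (∈-filter⁺ (λ v → ¬? (v ∈ᵛ? var C)) (∈-map⁺ u D∈) uD∉)))

  invMap-pure : ∀ {H} → H ⊆S dope u F → invMap F u (pure H) ≈S H
  invMap-pure {H} H⊆G = ⊆H , ⊇H
    where
    ⊆H : invMap F u (pure H) ⊆S H
    ⊆H E E∈ with ∈S-invMap⁻ {C = pure H} E∈
    ... | D , D∈ , uD∈ , e with ∈-map⁻ proj₁ uD∈
    ... | _ , y∈ , refl = ∈S-resp-≈C e (u∈lits⇒dope1∈S H⊆G D∈ (proj₁ (∈-pure⁻ H y∈)))
    ⊇H : H ⊆S invMap F u (pure H)
    ⊇H E E∈ with ∈S-dope⁻ (H⊆G E E∈)
    ... | D , D∈ , e = ∈S-invMap⁺ D∈ (var⁺ (∈-pure⁺ H uD∈H ¬uD∈H)) e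
      where
      uD∈H : (u D , true) ∈ lits H
      uD∈H = ∈S-lits (≈C⇒⊆C (≈C-sym e) _ (here refl)) E∈
      ¬uD∈H : (u D , false) ∉ lits H
      ¬uD∈H m with u-positive D∈ (⊆S-lits H⊆G _ m)
      ... | ()

  u∈var⇒u∈ : ∀ {C D} → Prc0 (dope u F) C → D ∈ F → u D ∈ var C → (u D , true) ∈ C
  u∈var⇒u∈ {C} prc D∈ uD∈ with ∈-map⁻ proj₁ uD∈
  ... | (v , b) , y∈ , eq = subst (_∈ C) (cong₂ _,_ (sym eq) b≡true) y∈
    where
    b≡true : b ≡ true
    b≡true = u-positive D∈ (subst (λ w → (w , b) ∈ lits (dope u F)) (sym eq)
               (prc₀-⊆lits {H = dope u F} prc ⊆S-refl (proj₁ (proj₂ prc)) (v , b) y∈))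

  -- A subclause C' of pure(H) implied by D(F) is implied by H, for which H is still
  -- minimal; so pure(H) ⊆ C'.
  mps⇒prc₀ : ∀ {H} → InMps (dope u F) H → Prc0 (dope u F) (pure H)
  mps⇒prc₀ {H} (H⊆G , C , cC , mps) = pure-isClause H , ⊨-mono H⊆G (mps-⊨-pure cC mps) , minimal
    where
    minimal : ∀ C' → IsClause C' → C' ⊆C pure H → dope u F ⊨ C' → pure H ⊆C C'
    minimal C' _ C'⊆pure G⊨C' =
      mps-pure⊆C (MPSFor-⊆C mps (λ x x∈ → mps-pure⊆C mps x (C'⊆pure x x∈)) H⊨C')
      where
      H⊨C' : H ⊨ C'
      H⊨C' = ⊨-mono (⊆S-trans (invMap-mono C'⊆pure) (proj₁ (invMap-pure H⊆G))) (invMap-⊨ G⊨C')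

  invMap-MPSFor : ∀ {C} → Prc0 (dope u F) C → MPSFor (invMap F u C) C
  invMap-MPSFor {C} prc = invMap-⊨ (proj₁ (proj₂ prc)) , minimal
    where
    minimal : ∀ K' → K' ⊂S invMap F u C → ¬ (K' ⊨ C)
    minimal K' (K'⊆K , K⊈K') K'⊨C = K⊈K' K⊆K'
      where
      K'⊆G : K' ⊆S dope u F
      K'⊆G = ⊆S-trans K'⊆K (invMap-⊆S C)
      K⊆K' : invMap F u C ⊆S K'
      K⊆K' E E∈ with ∈S-invMap⁻ {C = C} E∈
      ... | D , D∈ , uD∈ , e = ∈S-resp-≈C e (u∈lits⇒dope1∈S K'⊆G D∈
            (prc₀-⊆lits prc K'⊆G K'⊨C _ (u∈var⇒u∈ prc D∈ uD∈)))

  pure-invMap : ∀ {C} → Prc0 (dope u F) C → pure (invMap F u C) ≈C C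
  pure-invMap {C} prc x = mk⇔ (mps-pure⊆C mps x) λ x∈C →
    ∈-pure⁺ (invMap F u C) (prc₀-⊆lits prc (invMap-⊆S C) (proj₁ mps) x x∈C)
      (mps-compl∉ mps x∈C)
    where
    mps : MPSFor (invMap F u C) C
    mps = invMap-MPSFor prc

  pure-injective : ∀ {H H'} → H ⊆S dope u F → H' ⊆S dope u F → pure H ≈C pure H' → H ≈S H'
  pure-injective H⊆G H'⊆G e = via e H⊆G H'⊆G , via (≈C-sym e) H'⊆G H⊆G
    where
    via : ∀ {H H'} → pure H ≈C pure H' → H ⊆S dope u F → H' ⊆S dope u F → H ⊆S H'
    via e H⊆G H'⊆G =
      ⊆S-trans (proj₂ (invMap-pure H⊆G))
        (⊆S-trans (invMap-mono (≈C⇒⊆C e)) (proj₁ (invMap-pure H'⊆G)))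

  invMap-inverse : ∀ {C} → Prc0 (dope u F) C →
    InMps (dope u F) (invMap F u C) × pure (invMap F u C) ≈C C
  invMap-inverse {C} prc = (invMap-⊆S C , C , proj₁ prc , invMap-MPSFor prc) , pure-invMap prc

lemma4p17 : (F : ClauseSet) → All IsClause F → (u : Clause → Var) → ValidDoping F u →
    ((∀ H → InMps (dope u F) H → Prc0 (dope u F) (pure H)) ×
    (∀ H H' → InMps (dope u F) H → InMps (dope u F) H' → pure H ≈C pure H' → H ≈S H') ×
    (∀ C → Prc0 (dope u F) C → Σ ClauseSet (λ H → InMps (dope u F) H × pure H ≈C C))) ×
    ((∀ C → Prc0 (dope u F) C → InMps (dope u F) (invMap F u C) × pure (invMap F u C) ≈C C) ×
    (∀ H → InMps (dope u F) H → invMap F u (pure H) ≈S H))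
lemma4p17 F _ u (u-injective , _ , u-fresh) =
  ((λ H → mps⇒prc₀) ,
   (λ H H' mps mps' → pure-injective (proj₁ mps) (proj₁ mps')) ,
   (λ C prc → invMap F u C , invMap-inverse prc)) ,
  ((λ C → invMap-inverse) ,
   (λ H mps → invMap-pure (proj₁ mps)))
  where
  open Doping F u u-injective u-fresh
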